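{- For $k\ge2$ the function $\tilde p_k$ on $\mathbb Y$ belongs to $\mathbb A$, and $$\tilde p_k=\sum_{j=0}^{[\frac{k-1}2]}\binom{k}{2j+1}2^{ -2j}\,p_{k-1-2j}.$$
   Context: For a Young diagram $\lambda$, $p_k(\lambda)=\sum_{i\ge1}[(\lambda_i-i+\tfrac12)^k-(-i+\tfrac12)^k]$, and $\mathbb A$ is the real algebra of functions on the set $\mathbb Y$ of Young diagrams generated by $1,p_1,p_2,\dots$. Draw $\lambda$ with row coordinate $r$ (downwards) and column coordinate $s$; its boundary polygonal line (up the $r$-axis, along the boundary of $\lambda$, along the $s$-axis), in coordinates $x=s-r$, $y=r+s$, is the graph of a piecewise linear function $y=\lambda(x)$ with slopes $\pm1$, equal to $|x|$ for large $|x|$. Let $x_1<\dots<x_{m+1}$ be its local minima and $y_1<\dots<y_m$ its local maxima. Define $\tilde p_k(\lambda)=\sum_{i=1}^{m+1}x_i^k-\sum_{j=1}^m y_j^k$; equivalently $\tilde p_k(\lambda)=k(k-1)\int_{\mathbb R}x^{k-2}\sigma(x)\,dx$ for $k\ge2$, where $\sigma(x)=\frac12(\lambda(x)-|x|)$. -}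

module Defs where

open import Data.Nat as ℕ using (ℕ; zero; suc; _<_; _≥_)
open import Data.Nat.Combinatorics using (_C_)
open import Data.Integer as ℤ using (ℤ; +_; ∣_∣)
open import Data.Rational as ℚ using (ℚ; 0ℚ; 1ℚ; ½)
open import Data.List using (List; []; _∷_; length; map; foldr; upTo; filter; zip; head)
open import Data.List.Relation.Unary.All using (All)
open import Data.List.Relation.Unary.Linked using (Linked)
open import Data.Maybe using (fromMaybe)
open import Data.Product using (_×_; _,_; proj₁; proj₂)
open import Relation.Nullary.Decidable using (_×-dec_; ⌊_⌋)
open import Data.Bool using (if_then_else_)

record YoungDiagram : Set where
  constructor yd
  field
    rows     : List ℕ
    nonincr  : Linked _≥_ rows
    positive : All (0 <_) rows
open YoungDiagram public

_^ℚ_ : ℚ → ℕ → ℚ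
q ^ℚ zero  = 1ℚ
q ^ℚ suc n = q ℚ.* (q ^ℚ n)

sumℚ : List ℚ → ℚ
sumℚ = foldr ℚ._+_ 0ℚ

ℤtoℚ : ℤ → ℚ
ℤtoℚ z = z ℚ./ 1

ℕtoℚ : ℕ → ℚ
ℕtoℚ n = ℤtoℚ (+ n)

-- rows paired with their (1-based) row index i
indexedRows : YoungDiagram → List (ℕ × ℕ)
indexedRows λ′ = zip (map suc (upTo (length (rows λ′)))) (rows λ′)

-- p_k(λ) = Σ_{i≥1} [(λ_i - i + 1/2)^k - (-i + 1/2)^k]   (terms with i > ℓ(λ) vanish)
p : ℕ → YoungDiagram → ℚ
p k λ′ = sumℚ (map term (indexedRows λ′))
  where
  term : ℕ × ℕ → ℚ
  term (i , λi) = ((ℕtoℚ λi ℚ.- ℕtoℚ i ℚ.+ ½) ^ℚ k) ℚ.- ((ℚ.- ℕtoℚ i ℚ.+ ½) ^ℚ k)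

-- number of boxes (i , j) of λ (row i, column j, 1-based) with content j - i = x
boxesOnDiagonal : YoungDiagram → ℤ → ℕ
boxesOnDiagonal λ′ x = length (filter dec (indexedRows λ′))
  where
  dec = λ (r : ℕ × ℕ) →
    (+ 1 ℤ.≤? (+ proj₁ r) ℤ.+ x) ×-dec ((+ proj₁ r) ℤ.+ x ℤ.≤? + proj₂ r)

-- The boundary function y = λ(x) in rotated coordinates x = s - r, y = r + s,
-- evaluated at integer x: walking along the line s - r = x from the axes, each
-- box of content x raises y by 2, so λ(x) = |x| + 2·#{boxes of content x}.
-- (λ(x) is linear with slope ±1 between consecutive integers.)
profile : YoungDiagram → ℤ → ℤ
profile λ′ x = (+ ∣ x ∣) ℤ.+ (+ 2) ℤ.* (+ boxesOnDiagonal λ′ x)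

isLocalMin : YoungDiagram → ℤ → Data.Bool.Bool
isLocalMin λ′ x = ⌊ (profile λ′ x ℤ.<? profile λ′ (x ℤ.- + 1))
                   ×-dec (profile λ′ x ℤ.<? profile λ′ (x ℤ.+ + 1)) ⌋

isLocalMax : YoungDiagram → ℤ → Data.Bool.Bool
isLocalMax λ′ x = ⌊ (profile λ′ (x ℤ.- + 1) ℤ.<? profile λ′ x)
                   ×-dec (profile λ′ (x ℤ.+ + 1) ℤ.<? profile λ′ x) ⌋

-- integer window [-(ℓ+1), λ₁+1] that contains all extrema of the profile
window : YoungDiagram → List ℤ
window λ′ = map (λ n → (+ n) ℤ.- (+ (l ℕ.+ 1))) (upTo (l ℕ.+ λ₁ ℕ.+ 3))
  where
  l  = length (rows λ′)
  λ₁ = fromMaybe 0 (head (rows λ′))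

p̃ : ℕ → YoungDiagram → ℚ
p̃ k λ′ = sumℚ (map f (window λ′))
  where
  f : ℤ → ℚ
  f x = (if isLocalMin λ′ x then ℤtoℚ x ^ℚ k else 0ℚ)
        ℚ.- (if isLocalMax λ′ x then ℤtoℚ x ^ℚ k else 0ℚ)

rhs : ℕ → YoungDiagram → ℚ
rhs k λ′ = sumℚ (map t (upTo (suc ((k ℕ.∸ 1) ℕ./ 2))))
  where
  t : ℕ → ℚ
  t j = ℕtoℚ (k C (2 ℕ.* j ℕ.+ 1)) ℚ.* ((ℚ.1/ (+ 4 ℚ./ 1)) ^ℚ j)
        ℚ.* p (k ℕ.∸ 1 ℕ.∸ 2 ℕ.* j) λ′

-- The profile λ(x) = |x| + 2 c(x), where c(x) counts the boxes of content x, moves by ±1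
-- between consecutive integers, so at x ≠ 0 being a local minimum minus being a local
-- maximum equals ½ Δ²λ(x) = Δ²c(x); as xᵏ vanishes at 0, p̃ₖ(λ) = Σₓ Δ²c(x) xᵏ.  Since Δ² is
-- self-adjoint this is the sum over all boxes of Δ²(xᵏ) at their contents, which telescopes
-- along row i (contents 1 − i, …, λᵢ − i) to ∇(λᵢ − i + 1) − ∇(1 − i), with ∇(c) = cᵏ − (c − 1)ᵏ.
-- Finally (u + ½)ᵏ − (u − ½)ᵏ = Σⱼ C(k, 2j+1) 4⁻ʲ u^(k−1−2j) by the binomial theorem, and
-- u = λᵢ − i + ½ and u = −i + ½ produce the terms of p_(k−1−2j).

module Submission where

open import Defs
open import Algebra.Bundles using (CommutativeRing)
import Algebra.Properties.CommutativeSemiring.Binomial as Binomial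
import Algebra.Properties.Semiring.Exp as Exp
import Algebra.Properties.Semiring.Mult as Mult
import Algebra.Properties.Semiring.Sum as SemiringSum
open import Data.Bool using (true; false; T; if_then_else_; _∧_)
open import Data.Fin using (Fin; toℕ)
open import Data.Integer as ℤ using (ℤ; +_; -[1+_])
import Data.Integer.Properties as ℤ
import Data.Integer.Solver as ℤ-Solver
open import Data.List using (List; []; _∷_; map; applyUpTo; upTo; length; head; zip; filter)
import Data.List.Properties as List
open import Data.List.Relation.Unary.All as All using (All; []; _∷_)
open import Data.List.Relation.Unary.Linked as Linked using (Linked; []; [-]; _∷_)
open import Data.List.Relation.Unary.Linked.Properties using (Linked⇒All)
open import Data.Maybe using (fromMaybe)
open import Data.Nat as ℕ using (ℕ; zero; suc; _≤_; _<_; _≥_; _∸_; z≤n; s≤s)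
import Data.Nat.Properties as ℕ
import Data.Nat.Solver as ℕ-Solver
open import Data.Nat.Combinatorics using (_C_; k>n⇒nCk≡0)
open import Data.Nat.Coprimality as Coprime using ()
open import Data.Nat.DivMod using (m≡m%n+[m/n]*n; m%n<n; m/n≤m)
open import Data.Product using (_×_; _,_; ∃; proj₁; proj₂)
open import Data.Rational as ℚ using (ℚ; mkℚ; 0ℚ; 1ℚ; ½)
import Data.Rational.Properties as ℚ
open import Data.Rational.Solver using (module +-*-Solver)
open import Data.Sum as Sum using (_⊎_; inj₁; inj₂)
open import Data.Unit using (tt)
open import Function using (_∘_)
open import Relation.Binary.Definitions using (tri<; tri≈; tri>)
open import Relation.Binary.PropositionalEquality
open import Relation.Nullary using (Dec; yes; no; does; contradiction)
open import Relation.Nullary.Decidable using (_×-dec_; isYes≗does)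

open +-*-Solver
module ℤ-Ring = ℤ-Solver.+-*-Solver
module ℕ-Ring = ℕ-Solver.+-*-Solver

ℤtoℚ-mkℚ : ∀ z → ℤtoℚ z ≡ mkℚ z 0 (Coprime.sym (Coprime.1-coprimeTo ℤ.∣ z ∣))
ℤtoℚ-mkℚ (+ n)    = ℚ.normalize-coprime (Coprime.sym (Coprime.1-coprimeTo n))
ℤtoℚ-mkℚ -[1+ n ] = cong ℚ.-_ (ℚ.normalize-coprime (Coprime.sym (Coprime.1-coprimeTo (suc n))))

ℤtoℚ-+ : ∀ a b → ℤtoℚ (a ℤ.+ b) ≡ ℤtoℚ a ℚ.+ ℤtoℚ b
ℤtoℚ-+ a b rewrite ℤtoℚ-mkℚ a | ℤtoℚ-mkℚ b =
  cong ℤtoℚ (cong₂ ℤ._+_ (sym (ℤ.*-identityʳ a)) (sym (ℤ.*-identityʳ b)))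

ℤtoℚ-neg : ∀ a → ℤtoℚ (ℤ.- a) ≡ ℚ.- ℤtoℚ a
ℤtoℚ-neg (+ zero)  = refl
ℤtoℚ-neg (+ suc n) = refl
ℤtoℚ-neg -[1+ n ]  = solve 1 (λ q → q := :- (:- q)) refl (ℤtoℚ (+ suc n))

ℕtoℚ-+ : ∀ m n → ℕtoℚ (m ℕ.+ n) ≡ ℕtoℚ m ℚ.+ ℕtoℚ n
ℕtoℚ-+ m n = ℤtoℚ-+ (+ m) (+ n)

ℕtoℚ-suc : ∀ n → ℕtoℚ (suc n) ≡ 1ℚ ℚ.+ ℕtoℚ n
ℕtoℚ-suc = ℕtoℚ-+ 1

∑< : ℕ → (ℕ → ℚ) → ℚ
∑< zero    f = 0ℚ
∑< (suc n) f = f 0 ℚ.+ ∑< n (f ∘ suc)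

syntax ∑< n (λ i → e) = ∑[ i < n ] e

sumℚ-map-applyUpTo : ∀ (f : ℕ → ℚ) g n → sumℚ (map f (applyUpTo g n)) ≡ ∑< n (f ∘ g)
sumℚ-map-applyUpTo f g zero    = refl
sumℚ-map-applyUpTo f g (suc n) = cong (f (g 0) ℚ.+_) (sumℚ-map-applyUpTo f (g ∘ suc) n)

sumℚ-map-upTo : ∀ (f : ℕ → ℚ) n → sumℚ (map f (upTo n)) ≡ ∑< n f
sumℚ-map-upTo f = sumℚ-map-applyUpTo f (λ i → i)

∑-cong : ∀ n {f g : ℕ → ℚ} → (∀ i → i < n → f i ≡ g i) → ∑< n f ≡ ∑< n g
∑-cong zero    f≡g = refl
∑-cong (suc n) f≡g = cong₂ ℚ._+_ (f≡g 0 (s≤s z≤n)) (∑-cong n (λ i i<n → f≡g (suc i) (s≤s i<n)))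

∑-zero : ∀ n {f : ℕ → ℚ} → (∀ i → i < n → f i ≡ 0ℚ) → ∑< n f ≡ 0ℚ
∑-zero zero    f≡0 = refl
∑-zero (suc n) f≡0 =
  trans (cong₂ ℚ._+_ (f≡0 0 (s≤s z≤n)) (∑-zero n (λ i i<n → f≡0 (suc i) (s≤s i<n)))) (ℚ.+-identityʳ 0ℚ)

∑-distrib-+ : ∀ n (f g : ℕ → ℚ) → ∑[ i < n ] (f i ℚ.+ g i) ≡ ∑< n f ℚ.+ ∑< n g
∑-distrib-+ zero    f g = refl
∑-distrib-+ (suc n) f g =
  trans (cong (f 0 ℚ.+ g 0 ℚ.+_) (∑-distrib-+ n (f ∘ suc) (g ∘ suc)))
        (solve 4 (λ a b c d → (a :+ b) :+ (c :+ d) := (a :+ c) :+ (b :+ d)) refl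
               (f 0) (g 0) (∑< n (f ∘ suc)) (∑< n (g ∘ suc)))

∑-distrib-- : ∀ n (f g : ℕ → ℚ) → ∑[ i < n ] (f i ℚ.- g i) ≡ ∑< n f ℚ.- ∑< n g
∑-distrib-- zero    f g = refl
∑-distrib-- (suc n) f g =
  trans (cong (f 0 ℚ.- g 0 ℚ.+_) (∑-distrib-- n (f ∘ suc) (g ∘ suc)))
        (solve 4 (λ a b c d → (a :- b) :+ (c :- d) := (a :+ c) :- (b :+ d)) refl
               (f 0) (g 0) (∑< n (f ∘ suc)) (∑< n (g ∘ suc)))

*-distribˡ-∑ : ∀ n c (f : ℕ → ℚ) → c ℚ.* ∑< n f ≡ ∑[ i < n ] (c ℚ.* f i)
*-distribˡ-∑ zero    c f = ℚ.*-zeroʳ c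
*-distribˡ-∑ (suc n) c f =
  trans (ℚ.*-distribˡ-+ c (f 0) (∑< n (f ∘ suc))) (cong (c ℚ.* f 0 ℚ.+_) (*-distribˡ-∑ n c (f ∘ suc)))

∑-telescope : ∀ n (g : ℕ → ℚ) → ∑[ i < n ] (g (suc i) ℚ.- g i) ≡ g n ℚ.- g 0
∑-telescope zero    g = sym (ℚ.+-inverseʳ (g 0))
∑-telescope (suc n) g =
  trans (cong (g 1 ℚ.- g 0 ℚ.+_) (∑-telescope n (g ∘ suc)))
        (solve 3 (λ a b c → (b :- a) :+ (c :- b) := c :- a) refl (g 0) (g 1) (g (suc n)))

∑-+-zeros : ∀ m d (f : ℕ → ℚ) → (∀ i → m ≤ i → f i ≡ 0ℚ) → ∑< (m ℕ.+ d) f ≡ ∑< m f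
∑-+-zeros zero    d f f≡0 = ∑-zero d (λ i _ → f≡0 i z≤n)
∑-+-zeros (suc m) d f f≡0 = cong (f 0 ℚ.+_) (∑-+-zeros m d (f ∘ suc) (λ i m≤i → f≡0 (suc i) (s≤s m≤i)))

∑-truncate : ∀ {m n} (f : ℕ → ℚ) → m ≤ n → (∀ i → m ≤ i → f i ≡ 0ℚ) → ∑< n f ≡ ∑< m f
∑-truncate {m} {n} f m≤n f≡0 =
  trans (cong (λ n → ∑< n f) (sym (ℕ.m+[n∸m]≡n m≤n))) (∑-+-zeros m (n ∸ m) f f≡0)

∑-pairs : ∀ n (f : ℕ → ℚ) → ∑< (2 ℕ.* n) f ≡ ∑[ j < n ] (f (2 ℕ.* j) ℚ.+ f (suc (2 ℕ.* j)))
∑-pairs zero    f = refl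
∑-pairs (suc n) f = begin
  ∑< (2 ℕ.* suc n) f
    ≡⟨ cong (λ m → ∑< m f) (ℕ.*-suc 2 n) ⟩
  f 0 ℚ.+ (f 1 ℚ.+ ∑< (2 ℕ.* n) (f ∘ suc ∘ suc))
    ≡⟨ ℚ.+-assoc (f 0) (f 1) _ ⟨
  f 0 ℚ.+ f 1 ℚ.+ ∑< (2 ℕ.* n) (f ∘ suc ∘ suc)
    ≡⟨ cong (f 0 ℚ.+ f 1 ℚ.+_) (∑-pairs n (f ∘ suc ∘ suc)) ⟩
  f 0 ℚ.+ f 1 ℚ.+ ∑[ j < n ] (f (2 ℕ.+ 2 ℕ.* j) ℚ.+ f (3 ℕ.+ 2 ℕ.* j))
    ≡⟨ cong (f 0 ℚ.+ f 1 ℚ.+_) (∑-cong n (λ j _ → cong (λ m → f m ℚ.+ f (suc m)) (sym (ℕ.*-suc 2 j)))) ⟩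
  ∑[ j < suc n ] (f (2 ℕ.* j) ℚ.+ f (suc (2 ℕ.* j))) ∎
  where open ≡-Reasoning

∑-single : ∀ {n m} (f : ℕ → ℚ) → m < n → (∀ i → i ≢ m → f i ≡ 0ℚ) → ∑< n f ≡ f m
∑-single {suc n} {zero} f _ f≡0 =
  trans (cong (f 0 ℚ.+_) (∑-zero n (λ i _ → f≡0 (suc i) λ ())) ) (ℚ.+-identityʳ (f 0))
∑-single {suc n} {suc m} f (s≤s m<n) f≡0 =
  trans (cong (ℚ._+ ∑< n (f ∘ suc)) (f≡0 0 λ ()))
        (trans (ℚ.+-identityˡ _) (∑-single (f ∘ suc) m<n (λ i i≢m → f≡0 (suc i) (i≢m ∘ ℕ.suc-injective))))

module _ {A : Set} where

  *-distribˡ-sumℚ : ∀ c (f : A → ℚ) xs → c ℚ.* sumℚ (map f xs) ≡ sumℚ (map (λ x → c ℚ.* f x) xs)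
  *-distribˡ-sumℚ c f []       = ℚ.*-zeroʳ c
  *-distribˡ-sumℚ c f (x ∷ xs) =
    trans (ℚ.*-distribˡ-+ c (f x) _) (cong (c ℚ.* f x ℚ.+_) (*-distribˡ-sumℚ c f xs))

  ∑-sumℚ-comm : ∀ n (F : ℕ → A → ℚ) xs →
                ∑[ j < n ] sumℚ (map (F j) xs) ≡ sumℚ (map (λ x → ∑[ j < n ] F j x) xs)
  ∑-sumℚ-comm n F []       = ∑-zero n (λ _ _ → refl)
  ∑-sumℚ-comm n F (x ∷ xs) =
    trans (∑-distrib-+ n (λ j → F j x) (λ j → sumℚ (map (F j) xs)))
          (cong (∑[ j < n ] F j x ℚ.+_) (∑-sumℚ-comm n F xs))

module ℚ-Binomial = Binomial (CommutativeRing.commutativeSemiring ℚ.+-*-commutativeRing)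
module ℚ-Exp = Exp (CommutativeRing.semiring ℚ.+-*-commutativeRing)
module ℚ-Mult = Mult (CommutativeRing.semiring ℚ.+-*-commutativeRing)
module ℚ-Sum = SemiringSum (CommutativeRing.semiring ℚ.+-*-commutativeRing)

^≡^ℚ : ∀ x n → x ℚ-Exp.^ n ≡ x ^ℚ n
^≡^ℚ x zero    = refl
^≡^ℚ x (suc n) = cong (x ℚ.*_) (^≡^ℚ x n)

×≡ℕtoℚ* : ∀ n x → n ℚ-Mult.× x ≡ ℕtoℚ n ℚ.* x
×≡ℕtoℚ* zero    x = sym (ℚ.*-zeroˡ x)
×≡ℕtoℚ* (suc n) x = begin
  x ℚ.+ n ℚ-Mult.× x           ≡⟨ cong (x ℚ.+_) (×≡ℕtoℚ* n x) ⟩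
  x ℚ.+ ℕtoℚ n ℚ.* x           ≡⟨ solve 2 (λ x n → x :+ n :* x := (con 1ℚ :+ n) :* x) refl x (ℕtoℚ n) ⟩
  (1ℚ ℚ.+ ℕtoℚ n) ℚ.* x        ≡⟨ cong (ℚ._* x) (ℕtoℚ-suc n) ⟨
  ℕtoℚ (suc n) ℚ.* x           ∎
  where open ≡-Reasoning

sum≡∑< : ∀ n (f : ℕ → ℚ) → ℚ-Sum.sum (λ (i : Fin n) → f (toℕ i)) ≡ ∑< n f
sum≡∑< zero    f = refl
sum≡∑< (suc n) f = cong (f 0 ℚ.+_) (sum≡∑< n (f ∘ suc))

binomial : ∀ x y n → (x ℚ.+ y) ^ℚ n ≡ ∑[ m < suc n ] (ℕtoℚ (n C m) ℚ.* (x ^ℚ m ℚ.* y ^ℚ (n ∸ m)))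
binomial x y n = begin
  (x ℚ.+ y) ^ℚ n
    ≡⟨ ^≡^ℚ (x ℚ.+ y) n ⟨
  (x ℚ.+ y) ℚ-Exp.^ n
    ≡⟨ ℚ-Binomial.theorem n x y ⟩
  ℚ-Binomial.binomialExpansion x y n
    ≡⟨ sum≡∑< (suc n) (λ m → (n C m) ℚ-Mult.× (x ℚ-Exp.^ m ℚ.* y ℚ-Exp.^ (n ∸ m))) ⟩
  ∑[ m < suc n ] ((n C m) ℚ-Mult.× (x ℚ-Exp.^ m ℚ.* y ℚ-Exp.^ (n ∸ m)))
    ≡⟨ ∑-cong (suc n) (λ m _ → trans (×≡ℕtoℚ* (n C m) _)
                                     (cong (ℕtoℚ (n C m) ℚ.*_) (cong₂ ℚ._*_ (^≡^ℚ x m) (^≡^ℚ y (n ∸ m))))) ⟩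
  ∑[ m < suc n ] (ℕtoℚ (n C m) ℚ.* (x ^ℚ m ℚ.* y ^ℚ (n ∸ m))) ∎
  where open ≡-Reasoning

^ℚ-2* : ∀ a j → a ^ℚ (2 ℕ.* j) ≡ (a ℚ.* a) ^ℚ j
^ℚ-2* a zero    = refl
^ℚ-2* a (suc j) = begin
  a ^ℚ (2 ℕ.* suc j)            ≡⟨ cong (a ^ℚ_) (ℕ.*-suc 2 j) ⟩
  a ℚ.* (a ℚ.* a ^ℚ (2 ℕ.* j))  ≡⟨ ℚ.*-assoc a a _ ⟨
  a ℚ.* a ℚ.* a ^ℚ (2 ℕ.* j)    ≡⟨ cong (a ℚ.* a ℚ.*_) (^ℚ-2* a j) ⟩
  (a ℚ.* a) ^ℚ suc j            ∎
  where open ≡-Reasoning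

^ℚ-2*-neg : ∀ a j → (ℚ.- a) ^ℚ (2 ℕ.* j) ≡ (a ℚ.* a) ^ℚ j
^ℚ-2*-neg a j = trans (^ℚ-2* (ℚ.- a) j) (cong (_^ℚ j) (solve 1 (λ a → (:- a) :* (:- a) := a :* a) refl a))

even-power-difference : ∀ a j → a ^ℚ (2 ℕ.* j) ℚ.- (ℚ.- a) ^ℚ (2 ℕ.* j) ≡ 0ℚ
even-power-difference a j =
  trans (cong₂ ℚ._-_ (^ℚ-2* a j) (^ℚ-2*-neg a j)) (ℚ.+-inverseʳ ((a ℚ.* a) ^ℚ j))

odd-power-difference : ∀ a j → a ^ℚ suc (2 ℕ.* j) ℚ.- (ℚ.- a) ^ℚ suc (2 ℕ.* j) ≡ (a ℚ.+ a) ℚ.* (a ℚ.* a) ^ℚ j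
odd-power-difference a j =
  trans (cong₂ ℚ._-_ (cong (a ℚ.*_) (^ℚ-2* a j)) (cong (ℚ.- a ℚ.*_) (^ℚ-2*-neg a j)))
        (solve 2 (λ a z → a :* z :- (:- a) :* z := (a :+ a) :* z) refl a ((a ℚ.* a) ^ℚ j))

¼ : ℚ
¼ = ℚ.1/ (+ 4 ℚ./ 1)

oddTerms : ℕ → ℕ
oddTerms k = suc ((k ∸ 1) ℕ./ 2)

oddCoefficient : ℕ → ℕ → ℚ
oddCoefficient k j = ℕtoℚ (k C (2 ℕ.* j ℕ.+ 1)) ℚ.* ¼ ^ℚ j

oddDegree : ℕ → ℕ → ℕ
oddDegree k j = k ∸ 1 ∸ 2 ℕ.* j

oddPart : ℕ → ℚ → ℚ
oddPart k w = ∑[ j < oddTerms k ] (oddCoefficient k j ℚ.* w ^ℚ oddDegree k j)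

/2<⇒<2* : ∀ n j → n ℕ./ 2 < j → n < 2 ℕ.* j
/2<⇒<2* n j n/2<j = begin-strict
  n                           ≡⟨ m≡m%n+[m/n]*n n 2 ⟩
  n ℕ.% 2 ℕ.+ n ℕ./ 2 ℕ.* 2   <⟨ ℕ.+-monoˡ-< (n ℕ./ 2 ℕ.* 2) (m%n<n n 2) ⟩
  suc (n ℕ./ 2) ℕ.* 2         ≡⟨ ℕ.*-comm (suc (n ℕ./ 2)) 2 ⟩
  2 ℕ.* suc (n ℕ./ 2)         ≤⟨ ℕ.*-monoʳ-≤ 2 n/2<j ⟩
  2 ℕ.* j                     ∎
  where open ℕ.≤-Reasoning

binomial-difference : ∀ x y w n → (x ℚ.+ w) ^ℚ n ℚ.- (y ℚ.+ w) ^ℚ n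
  ≡ ∑[ m < suc n ] (ℕtoℚ (n C m) ℚ.* ((x ^ℚ m ℚ.- y ^ℚ m) ℚ.* w ^ℚ (n ∸ m)))
binomial-difference x y w n = begin
  (x ℚ.+ w) ^ℚ n ℚ.- (y ℚ.+ w) ^ℚ n
    ≡⟨ cong₂ ℚ._-_ (binomial x w n) (binomial y w n) ⟩
  ∑< (suc n) (term x) ℚ.- ∑< (suc n) (term y)
    ≡⟨ ∑-distrib-- (suc n) (term x) (term y) ⟨
  ∑[ m < suc n ] (term x m ℚ.- term y m)
    ≡⟨ ∑-cong (suc n) (λ m _ → solve 4 (λ c a b z → c :* (a :* z) :- c :* (b :* z) := c :* ((a :- b) :* z)) refl
                                        (ℕtoℚ (n C m)) (x ^ℚ m) (y ^ℚ m) (w ^ℚ (n ∸ m))) ⟩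
  ∑[ m < suc n ] (ℕtoℚ (n C m) ℚ.* ((x ^ℚ m ℚ.- y ^ℚ m) ℚ.* w ^ℚ (n ∸ m))) ∎
  where
  open ≡-Reasoning
  term : ℚ → ℕ → ℚ
  term z m = ℕtoℚ (n C m) ℚ.* (z ^ℚ m ℚ.* w ^ℚ (n ∸ m))

½-odd-power-difference : ∀ j → ½ ^ℚ suc (2 ℕ.* j) ℚ.- (ℚ.- ½) ^ℚ suc (2 ℕ.* j) ≡ ¼ ^ℚ j
½-odd-power-difference j = trans (odd-power-difference ½ j) (ℚ.*-identityˡ (¼ ^ℚ j))

-- Even powers of ±½ cancel and odd ones leave ¼ ^ j.
½-difference : ∀ k w → (½ ℚ.+ w) ^ℚ k ℚ.- (ℚ.- ½ ℚ.+ w) ^ℚ k ≡ oddPart k w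
½-difference zero    w = refl
½-difference (suc k) w = begin
  (½ ℚ.+ w) ^ℚ K ℚ.- (ℚ.- ½ ℚ.+ w) ^ℚ K
    ≡⟨ binomial-difference ½ (ℚ.- ½) w K ⟩
  ∑< (suc K) term
    ≡⟨ ∑-truncate term (ℕ.m≤m+n (suc K) (suc K ℕ.+ 0)) term-vanishes ⟨
  ∑< (2 ℕ.* suc K) term
    ≡⟨ ∑-pairs (suc K) term ⟩
  ∑[ j < suc K ] (term (2 ℕ.* j) ℚ.+ term (suc (2 ℕ.* j)))
    ≡⟨ ∑-cong (suc K) (λ j _ → term-pair j) ⟩
  ∑< (suc K) oddTerm
    ≡⟨ ∑-truncate oddTerm (s≤s (ℕ.m≤n⇒m≤1+n (m/n≤m k 2))) oddTerm-vanishes ⟩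
  oddPart K w ∎
  where
  open ≡-Reasoning
  K : ℕ
  K = suc k
  term : ℕ → ℚ
  term m = ℕtoℚ (K C m) ℚ.* ((½ ^ℚ m ℚ.- (ℚ.- ½) ^ℚ m) ℚ.* w ^ℚ (K ∸ m))
  oddTerm : ℕ → ℚ
  oddTerm j = oddCoefficient K j ℚ.* w ^ℚ oddDegree K j
  term-vanishes : ∀ m → suc K ≤ m → term m ≡ 0ℚ
  term-vanishes m K<m rewrite k>n⇒nCk≡0 K<m = ℚ.*-zeroˡ ((½ ^ℚ m ℚ.- (ℚ.- ½) ^ℚ m) ℚ.* w ^ℚ (K ∸ m))
  oddTerm-vanishes : ∀ j → oddTerms K ≤ j → oddTerm j ≡ 0ℚ
  oddTerm-vanishes j k/2<j rewrite ℕ.+-comm (2 ℕ.* j) 1 | k>n⇒nCk≡0 (s≤s (/2<⇒<2* k j k/2<j)) =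
    trans (cong (ℚ._* w ^ℚ oddDegree K j) (ℚ.*-zeroˡ (¼ ^ℚ j))) (ℚ.*-zeroˡ (w ^ℚ oddDegree K j))
  term-pair : ∀ j → term (2 ℕ.* j) ℚ.+ term (suc (2 ℕ.* j)) ≡ oddTerm j
  term-pair j = begin
    term (2 ℕ.* j) ℚ.+ term (suc (2 ℕ.* j))
      ≡⟨ cong₂ ℚ._+_ (cong (λ d → ℕtoℚ (K C (2 ℕ.* j)) ℚ.* (d ℚ.* w ^ℚ (K ∸ 2 ℕ.* j))) (even-power-difference ½ j))
                     (cong (λ d → ℕtoℚ (K C suc (2 ℕ.* j)) ℚ.* (d ℚ.* w ^ℚ oddDegree K j)) (½-odd-power-difference j)) ⟩
    ℕtoℚ (K C (2 ℕ.* j)) ℚ.* (0ℚ ℚ.* w ^ℚ (K ∸ 2 ℕ.* j)) ℚ.+ ℕtoℚ (K C suc (2 ℕ.* j)) ℚ.* (¼ ^ℚ j ℚ.* w ^ℚ oddDegree K j)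
      ≡⟨ solve 5 (λ c d q x y → c :* (con 0ℚ :* x) :+ d :* (q :* y) := d :* q :* y) refl
               (ℕtoℚ (K C (2 ℕ.* j))) (ℕtoℚ (K C suc (2 ℕ.* j))) (¼ ^ℚ j) (w ^ℚ (K ∸ 2 ℕ.* j)) (w ^ℚ oddDegree K j) ⟩
    ℕtoℚ (K C suc (2 ℕ.* j)) ℚ.* ¼ ^ℚ j ℚ.* w ^ℚ oddDegree K j
      ≡⟨ cong (λ i → ℕtoℚ (K C i) ℚ.* ¼ ^ℚ j ℚ.* w ^ℚ oddDegree K j) (ℕ.+-comm 1 (2 ℕ.* j)) ⟩
    oddTerm j ∎

-- The library's ℤ.suc and ℤ.pred are defined through _⊖_ and do not
-- reduce on variables; these compute by pattern matching.
sucℤ : ℤ → ℤ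
sucℤ (+ n)         = + suc n
sucℤ -[1+ zero ]   = + 0
sucℤ -[1+ suc m ]  = -[1+ m ]

predℤ : ℤ → ℤ
predℤ (+ zero)  = -[1+ 0 ]
predℤ (+ suc n) = + n
predℤ -[1+ m ]  = -[1+ suc m ]

sucℤ-predℤ : ∀ y → sucℤ (predℤ y) ≡ y
sucℤ-predℤ (+ zero)  = refl
sucℤ-predℤ (+ suc n) = refl
sucℤ-predℤ -[1+ m ]  = refl

predℤ-sucℤ : ∀ y → predℤ (sucℤ y) ≡ y
predℤ-sucℤ (+ n)          = refl
predℤ-sucℤ -[1+ zero ]    = refl
predℤ-sucℤ -[1+ suc m ]   = refl

sucℤ≡1+ : ∀ y → sucℤ y ≡ + 1 ℤ.+ y
sucℤ≡1+ (+ n)          = refl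
sucℤ≡1+ -[1+ zero ]    = refl
sucℤ≡1+ -[1+ suc m ]   = refl

predℤ≡-1+ : ∀ y → predℤ y ≡ -[1+ 0 ] ℤ.+ y
predℤ≡-1+ (+ zero)  = refl
predℤ≡-1+ (+ suc n) = refl
predℤ≡-1+ -[1+ m ]  = refl

+1≡sucℤ : ∀ y → y ℤ.+ + 1 ≡ sucℤ y
+1≡sucℤ y = trans (ℤ.+-comm y (+ 1)) (sym (sucℤ≡1+ y))

-1≡predℤ : ∀ y → y ℤ.- + 1 ≡ predℤ y
-1≡predℤ y = trans (ℤ.+-comm y -[1+ 0 ]) (sym (predℤ≡-1+ y))

sucℤ-+ʳ : ∀ x y → sucℤ (x ℤ.+ y) ≡ x ℤ.+ sucℤ y
sucℤ-+ʳ x y rewrite sucℤ≡1+ (x ℤ.+ y) | sucℤ≡1+ y =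
  ℤ-Ring.solve 2 (λ x y → ℤ-Ring.con (+ 1) ℤ-Ring.:+ (x ℤ-Ring.:+ y) ℤ-Ring.:= x ℤ-Ring.:+ (ℤ-Ring.con (+ 1) ℤ-Ring.:+ y)) refl x y

predℤ-+ʳ : ∀ x y → predℤ (x ℤ.+ y) ≡ x ℤ.+ predℤ y
predℤ-+ʳ x y rewrite predℤ≡-1+ (x ℤ.+ y) | predℤ≡-1+ y =
  ℤ-Ring.solve 2 (λ x y → ℤ-Ring.con -[1+ 0 ] ℤ-Ring.:+ (x ℤ-Ring.:+ y) ℤ-Ring.:= x ℤ-Ring.:+ (ℤ-Ring.con -[1+ 0 ] ℤ-Ring.:+ y)) refl x y

predℤ-neg : ∀ n → predℤ (ℤ.- + n) ≡ ℤ.- + suc n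
predℤ-neg zero    = refl
predℤ-neg (suc n) = refl

+m-+n≡+[m∸n] : ∀ {m n} → n ≤ m → + m ℤ.- + n ≡ + (m ∸ n)
+m-+n≡+[m∸n] {m} {n} n≤m = trans (ℤ.m-n≡m⊖n m n) (ℤ.⊖-≥ n≤m)

∣sucℤ-[1+m]∣≡m : ∀ m → ℤ.∣ sucℤ -[1+ m ] ∣ ≡ m
∣sucℤ-[1+m]∣≡m zero    = refl
∣sucℤ-[1+m]∣≡m (suc m) = refl

Δ² : (ℤ → ℚ) → ℤ → ℚ
Δ² φ y = φ (predℤ y) ℚ.+ φ (sucℤ y) ℚ.- (φ y ℚ.+ φ y)

∇ : (ℤ → ℚ) → ℤ → ℚ
∇ φ y = φ y ℚ.- φ (predℤ y)

Δ²-cong : ∀ {φ ψ : ℤ → ℚ} → (∀ y → φ y ≡ ψ y) → ∀ y → Δ² φ y ≡ Δ² ψ y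
Δ²-cong φ≡ψ y = cong₂ ℚ._-_ (cong₂ ℚ._+_ (φ≡ψ (predℤ y)) (φ≡ψ (sucℤ y))) (cong₂ ℚ._+_ (φ≡ψ y) (φ≡ψ y))

Δ²-+ : ∀ (φ ψ : ℤ → ℚ) y → Δ² (λ x → φ x ℚ.+ ψ x) y ≡ Δ² φ y ℚ.+ Δ² ψ y
Δ²-+ φ ψ y =
  solve 6 (λ a b c d e f → (a :+ b) :+ (c :+ d) :- ((e :+ f) :+ (e :+ f)) := (a :+ c :- (e :+ e)) :+ (b :+ d :- (f :+ f))) refl
    (φ (predℤ y)) (ψ (predℤ y)) (φ (sucℤ y)) (ψ (sucℤ y)) (φ y) (ψ y)

Δ²≡∇-∇ : ∀ φ y → Δ² φ y ≡ ∇ φ (sucℤ y) ℚ.- ∇ φ y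
Δ²≡∇-∇ φ y rewrite predℤ-sucℤ y =
  solve 3 (λ a b c → a :+ c :- (b :+ b) := (c :- b) :- (b :- a)) refl (φ (predℤ y)) (φ y) (φ (sucℤ y))

x+t-t≡x : ∀ x t → x ℤ.+ t ℤ.- t ≡ x
x+t-t≡x = ℤ-Ring.solve 2 (λ x t → x ℤ-Ring.:+ t ℤ-Ring.:- t ℤ-Ring.:= x) refl

x-t+t≡x : ∀ x t → x ℤ.- t ℤ.+ t ≡ x
x-t+t≡x = ℤ-Ring.solve 2 (λ x t → x ℤ-Ring.:- t ℤ-Ring.:+ t ℤ-Ring.:= x) refl

sucℤ-+ˡ : ∀ x y → sucℤ (x ℤ.+ y) ≡ sucℤ x ℤ.+ y
sucℤ-+ˡ x y = trans (cong sucℤ (ℤ.+-comm x y)) (trans (sucℤ-+ʳ y x) (ℤ.+-comm y (sucℤ x)))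

sucℤ[m-n]≡1+m-n : ∀ m n → sucℤ (+ m ℤ.- + n) ≡ + suc m ℤ.- + n
sucℤ[m-n]≡1+m-n m n = sucℤ-+ˡ (+ m) (ℤ.- + n)

predℤ[m-n]≡m-[1+n] : ∀ m n → predℤ (+ m ℤ.- + n) ≡ + m ℤ.- + suc n
predℤ[m-n]≡m-[1+n] m n = trans (predℤ-+ʳ (+ m) (ℤ.- + n)) (cong (λ u → + m ℤ.+ u) (predℤ-neg n))

sucℤ[m-[1+n]]≡m-n : ∀ m n → sucℤ (+ m ℤ.- + suc n) ≡ + m ℤ.- + n
sucℤ[m-[1+n]]≡m-n m n = trans (cong sucℤ (sym (predℤ[m-n]≡m-[1+n] m n))) (sucℤ-predℤ (+ m ℤ.- + n))

∇-pow : ∀ k c → ∇ (λ y → ℤtoℚ y ^ℚ k) (sucℤ c) ≡ oddPart k (ℤtoℚ c ℚ.+ ½)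
∇-pow k c = begin
  ℤtoℚ (sucℤ c) ^ℚ k ℚ.- ℤtoℚ (predℤ (sucℤ c)) ^ℚ k
    ≡⟨ cong₂ (λ u v → u ^ℚ k ℚ.- v ^ℚ k) upper lower ⟩
  (½ ℚ.+ w) ^ℚ k ℚ.- (ℚ.- ½ ℚ.+ w) ^ℚ k
    ≡⟨ ½-difference k w ⟩
  oddPart k w ∎
  where
  open ≡-Reasoning
  w : ℚ
  w = ℤtoℚ c ℚ.+ ½
  upper : ℤtoℚ (sucℤ c) ≡ ½ ℚ.+ w
  upper = trans (cong ℤtoℚ (sucℤ≡1+ c))
                (trans (ℤtoℚ-+ (+ 1) c) (solve 1 (λ x → con 1ℚ :+ x := con ½ :+ (x :+ con ½)) refl (ℤtoℚ c)))
  lower : ℤtoℚ (predℤ (sucℤ c)) ≡ ℚ.- ½ ℚ.+ w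
  lower = trans (cong ℤtoℚ (predℤ-sucℤ c)) (solve 1 (λ x → x := :- con ½ :+ (x :+ con ½)) refl (ℤtoℚ c))

-- Row t (counted from 0) of length a holds the boxes of contents −t, …, a − 1 − t,
-- so it contains inRow a (y + t) boxes of content y.
inRow : ℕ → ℤ → ℕ
inRow a (+ n)    = if n ℕ.<ᵇ a then 1 else 0
inRow a -[1+ _ ] = 0

boxesWithContent : List ℕ → ℤ → ℕ
boxesWithContent []       y = 0
boxesWithContent (a ∷ as) y = inRow a y ℕ.+ boxesWithContent as (sucℤ y)

indexFrom : ℕ → List ℕ → List (ℕ × ℕ)
indexFrom i []       = []
indexFrom i (a ∷ as) = (i , a) ∷ indexFrom (suc i) as

zip-applyUpTo : ∀ (f : ℕ → ℕ) i xs → (∀ n → f n ≡ i ℕ.+ n) →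
                zip (applyUpTo f (length xs)) xs ≡ indexFrom i xs
zip-applyUpTo f i []       _  = refl
zip-applyUpTo f i (a ∷ as) f≡ =
  cong₂ _∷_ (cong (_, a) (trans (f≡ 0) (ℕ.+-identityʳ i)))
            (zip-applyUpTo (f ∘ suc) (suc i) as (λ n → trans (f≡ (suc n)) (ℕ.+-suc i n)))

indexedRows≡indexFrom : ∀ λ′ → indexedRows λ′ ≡ indexFrom 1 (rows λ′)
indexedRows≡indexFrom λ′ =
  trans (cong (λ is → zip is (rows λ′)) (List.map-upTo suc (length (rows λ′))))
        (zip-applyUpTo suc 1 (rows λ′) (λ _ → refl))

onDiagonal? : (x : ℤ) (r : ℕ × ℕ) → Dec ((+ 1 ℤ.≤ + proj₁ r ℤ.+ x) × (+ proj₁ r ℤ.+ x ℤ.≤ + proj₂ r))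
onDiagonal? x r = (+ 1 ℤ.≤? + proj₁ r ℤ.+ x) ×-dec (+ proj₁ r ℤ.+ x ℤ.≤? + proj₂ r)

length-filter-∷ : ∀ {P : ℕ × ℕ → Set} (P? : ∀ r → Dec (P r)) r rs →
  length (filter P? (r ∷ rs)) ≡ (if does (P? r) then 1 else 0) ℕ.+ length (filter P? rs)
length-filter-∷ P? r rs with does (P? r)
... | true  = refl
... | false = refl

onDiagonal?≡inRow : ∀ y a → (if does ((+ 1 ℤ.≤? sucℤ y) ×-dec (sucℤ y ℤ.≤? + a)) then 1 else 0) ≡ inRow a y
onDiagonal?≡inRow (+ n)          a = refl
onDiagonal?≡inRow -[1+ zero ]    a = refl
onDiagonal?≡inRow -[1+ suc m ]   a = refl

filter-onDiagonal : ∀ xs t x →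
  length (filter (onDiagonal? x) (indexFrom (suc t) xs)) ≡ boxesWithContent xs (+ t ℤ.+ x)
filter-onDiagonal []       t x = refl
filter-onDiagonal (a ∷ as) t x = begin
  length (filter (onDiagonal? x) (indexFrom (suc t) (a ∷ as)))
    ≡⟨ length-filter-∷ (onDiagonal? x) (suc t , a) (indexFrom (suc (suc t)) as) ⟩
  (if does (onDiagonal? x (suc t , a)) then 1 else 0) ℕ.+ length (filter (onDiagonal? x) (indexFrom (suc (suc t)) as))
    ≡⟨ cong₂ ℕ._+_ (trans (cong (λ z → if does ((+ 1 ℤ.≤? z) ×-dec (z ℤ.≤? + a)) then 1 else 0) shift)
                          (onDiagonal?≡inRow (+ t ℤ.+ x) a))
                   (trans (filter-onDiagonal as (suc t) x) (cong (boxesWithContent as) shift)) ⟩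
  inRow a (+ t ℤ.+ x) ℕ.+ boxesWithContent as (sucℤ (+ t ℤ.+ x)) ∎
  where
  open ≡-Reasoning
  shift : + suc t ℤ.+ x ≡ sucℤ (+ t ℤ.+ x)
  shift = sym (sucℤ-+ˡ (+ t) x)

boxesOnDiagonal≡boxesWithContent : ∀ λ′ x → boxesOnDiagonal λ′ x ≡ boxesWithContent (rows λ′) x
boxesOnDiagonal≡boxesWithContent λ′ x =
  trans (cong (λ rs → length (filter (onDiagonal? x) rs)) (indexedRows≡indexFrom λ′))
        (trans (filter-onDiagonal (rows λ′) 0 x) (cong (boxesWithContent (rows λ′)) (ℤ.+-identityˡ x)))

inRow-< : ∀ {a n} → n < a → inRow a (+ n) ≡ 1
inRow-< {a} {n} n<a with n ℕ.<ᵇ a | ℕ.<⇒<ᵇ n<a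
... | true | _ = refl

inRow-≥ : ∀ {a n} → a ≤ n → inRow a (+ n) ≡ 0
inRow-≥ {a} {n} a≤n with n ℕ.<ᵇ a in eq
... | false = refl
... | true  = contradiction (ℕ.<ᵇ⇒< n a (subst T (sym eq) tt)) (ℕ.≤⇒≯ a≤n)

boxesWithContent-beyond : ∀ {xs m n} → All (_≤ m) xs → m ≤ n → boxesWithContent xs (+ n) ≡ 0
boxesWithContent-beyond []             _   = refl
boxesWithContent-beyond (a≤m ∷ as≤m) m≤n rewrite inRow-≥ (ℕ.≤-trans a≤m m≤n) =
  boxesWithContent-beyond as≤m (ℕ.m≤n⇒m≤1+n m≤n)

tail-≤-head : ∀ {a as} → Linked _≥_ (a ∷ as) → All (_≤ a) as
tail-≤-head [-]          = []
tail-≤-head (a≥b ∷ rest) = Linked⇒All (λ x≥y y≥z → ℕ.≤-trans y≥z x≥y) a≥b rest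

-- Moving one diagonal to the right, the number of boxes changes by at most one:
-- it cannot grow on the right of the main diagonal, nor shrink on its left.
ContentStep : ℤ → ℕ → ℕ → Set
ContentStep (+ _)    c c′ = c′ ≡ c ⊎ suc c′ ≡ c
ContentStep -[1+ _ ] c c′ = c′ ≡ c ⊎ c′ ≡ suc c

boxesWithContent-step : ∀ {xs} → Linked _≥_ xs → All (0 <_) xs → ∀ y →
  ContentStep y (boxesWithContent xs y) (boxesWithContent xs (sucℤ y))
boxesWithContent-step {[]} _ _ (+ _)    = inj₁ refl
boxesWithContent-step {[]} _ _ -[1+ _ ] = inj₁ refl
boxesWithContent-step {a ∷ as} sorted (_ ∷ pos) -[1+ suc m ] =
  boxesWithContent-step (Linked.tail sorted) pos -[1+ m ]
boxesWithContent-step {a ∷ as} sorted (0<a ∷ pos) -[1+ zero ]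
  rewrite inRow-< 0<a with boxesWithContent-step (Linked.tail sorted) pos (+ 0)
... | inj₁ c′≡c   = inj₂ (cong suc c′≡c)
... | inj₂ 1+c′≡c = inj₁ 1+c′≡c
boxesWithContent-step {a ∷ as} sorted (_ ∷ pos) (+ n) with ℕ.<-cmp (suc n) a
... | tri< 1+n<a _ _ rewrite inRow-< 1+n<a | inRow-< (ℕ.<-trans (ℕ.n<1+n n) 1+n<a) =
  Sum.map (cong suc) (cong suc) (boxesWithContent-step (Linked.tail sorted) pos (+ suc n))
... | tri≈ _ refl _
  rewrite inRow-< (ℕ.n<1+n n) | inRow-≥ (ℕ.≤-refl {suc n})
        | boxesWithContent-beyond (tail-≤-head sorted) (ℕ.≤-refl {suc n})
        | boxesWithContent-beyond (tail-≤-head sorted) (ℕ.n≤1+n (suc n)) = inj₂ refl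
... | tri> _ _ a<1+n
  rewrite inRow-≥ (ℕ.m<1+n⇒m≤n a<1+n) | inRow-≥ (ℕ.m≤n⇒m≤1+n (ℕ.m<1+n⇒m≤n a<1+n))
        | boxesWithContent-beyond (tail-≤-head sorted) (ℕ.m≤n⇒m≤1+n (ℕ.m<1+n⇒m≤n a<1+n))
        | boxesWithContent-beyond (tail-≤-head sorted) (ℕ.m≤n⇒m≤1+n (ℕ.m≤n⇒m≤1+n (ℕ.m<1+n⇒m≤n a<1+n))) = inj₁ refl

Adjacent : ℕ → ℕ → Set
Adjacent m n = m ≡ suc n ⊎ n ≡ suc m

profileℕ : List ℕ → ℤ → ℕ
profileℕ xs y = ℤ.∣ y ∣ ℕ.+ 2 ℕ.* boxesWithContent xs y

profile≡profileℕ : ∀ λ′ y → profile λ′ y ≡ + profileℕ (rows λ′) y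
profile≡profileℕ λ′ y rewrite boxesOnDiagonal≡boxesWithContent λ′ y =
  cong (λ z → + ℤ.∣ y ∣ ℤ.+ z) (sym (ℤ.pos-* 2 (boxesWithContent (rows λ′) y)))

+-2*suc : ∀ n c → n ℕ.+ 2 ℕ.* suc c ≡ suc (suc (n ℕ.+ 2 ℕ.* c))
+-2*suc n c =
  trans (cong (n ℕ.+_) (ℕ.*-suc 2 c)) (trans (ℕ.+-suc n (suc (2 ℕ.* c))) (cong suc (ℕ.+-suc n (2 ℕ.* c))))

profileℕ-adjacent : ∀ {xs} → Linked _≥_ xs → All (0 <_) xs → ∀ y →
                    Adjacent (profileℕ xs y) (profileℕ xs (sucℤ y))
profileℕ-adjacent sorted pos (+ n) with boxesWithContent-step sorted pos (+ n)
... | inj₁ c′≡c   rewrite c′≡c = inj₂ refl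
... | inj₂ 1+c′≡c rewrite sym 1+c′≡c = inj₁ (+-2*suc n _)
profileℕ-adjacent sorted pos -[1+ m ] with boxesWithContent-step sorted pos -[1+ m ]
... | inj₁ c′≡c   rewrite c′≡c   | ∣sucℤ-[1+m]∣≡m m = inj₁ refl
... | inj₂ c′≡1+c rewrite c′≡1+c | ∣sucℤ-[1+m]∣≡m m = inj₂ (+-2*suc m _)

n<ᵇ1+n : ∀ n → (n ℕ.<ᵇ suc n) ≡ true
n<ᵇ1+n n with n ℕ.<ᵇ suc n | ℕ.<⇒<ᵇ (ℕ.n<1+n n)
... | true | _ = refl

1+n<ᵇn : ∀ n → (suc n ℕ.<ᵇ n) ≡ false
1+n<ᵇn n with suc n ℕ.<ᵇ n in eq
... | false = refl
... | true  = contradiction (ℕ.<ᵇ⇒< (suc n) n (subst T (sym eq) tt)) (ℕ.≤⇒≯ (ℕ.n≤1+n n))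

extremum-indicator : ∀ {p₀ p₁ p₂} (X : ℚ) → Adjacent p₀ p₁ → Adjacent p₂ p₁ →
  (if (p₁ ℕ.<ᵇ p₀) ∧ (p₁ ℕ.<ᵇ p₂) then X else 0ℚ) ℚ.- (if (p₀ ℕ.<ᵇ p₁) ∧ (p₂ ℕ.<ᵇ p₁) then X else 0ℚ)
  ≡ ½ ℚ.* (ℕtoℚ p₀ ℚ.+ ℕtoℚ p₂ ℚ.- (ℕtoℚ p₁ ℚ.+ ℕtoℚ p₁)) ℚ.* X
extremum-indicator {p₁ = p} X (inj₁ refl) (inj₁ refl)
  rewrite n<ᵇ1+n p | 1+n<ᵇn p | ℕtoℚ-suc p =
  solve 2 (λ X a → X :- con 0ℚ := con ½ :* ((con 1ℚ :+ a) :+ (con 1ℚ :+ a) :- (a :+ a)) :* X) refl X (ℕtoℚ p)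
extremum-indicator {p₂ = p} X (inj₁ refl) (inj₂ refl)
  rewrite n<ᵇ1+n (suc p) | 1+n<ᵇn p | ℕtoℚ-suc (suc p) | ℕtoℚ-suc p =
  solve 2 (λ X a → con 0ℚ :- con 0ℚ := con ½ :* ((con 1ℚ :+ (con 1ℚ :+ a)) :+ a :- ((con 1ℚ :+ a) :+ (con 1ℚ :+ a))) :* X) refl X (ℕtoℚ p)
extremum-indicator {p₀ = p} X (inj₂ refl) (inj₁ refl)
  rewrite n<ᵇ1+n p | 1+n<ᵇn p | ℕtoℚ-suc (suc p) | ℕtoℚ-suc p =
  solve 2 (λ X a → con 0ℚ :- con 0ℚ := con ½ :* (a :+ (con 1ℚ :+ (con 1ℚ :+ a)) :- ((con 1ℚ :+ a) :+ (con 1ℚ :+ a))) :* X) refl X (ℕtoℚ p)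
extremum-indicator {p₀ = p} X (inj₂ refl) (inj₂ refl)
  rewrite n<ᵇ1+n p | 1+n<ᵇn p | ℕtoℚ-suc p =
  solve 2 (λ X a → con 0ℚ :- X := con ½ :* (a :+ a :- ((con 1ℚ :+ a) :+ (con 1ℚ :+ a))) :* X) refl X (ℕtoℚ p)

profile-at-neighbours : ∀ {A : Set} (test : ℤ → ℤ → ℤ → A) λ′ x →
  test (profile λ′ x) (profile λ′ (x ℤ.- + 1)) (profile λ′ (x ℤ.+ + 1))
  ≡ test (+ profileℕ (rows λ′) x) (+ profileℕ (rows λ′) (predℤ x)) (+ profileℕ (rows λ′) (sucℤ x))
profile-at-neighbours test λ′ x
  rewrite -1≡predℤ x | +1≡sucℤ x | profile≡profileℕ λ′ x
        | profile≡profileℕ λ′ (predℤ x) | profile≡profileℕ λ′ (sucℤ x) = refl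

isLocalMin≡ : ∀ λ′ x → isLocalMin λ′ x ≡
  (profileℕ (rows λ′) x ℕ.<ᵇ profileℕ (rows λ′) (predℤ x)) ∧ (profileℕ (rows λ′) x ℕ.<ᵇ profileℕ (rows λ′) (sucℤ x))
isLocalMin≡ λ′ x =
  trans (isYes≗does _) (profile-at-neighbours (λ a b c → does ((a ℤ.<? b) ×-dec (a ℤ.<? c))) λ′ x)

isLocalMax≡ : ∀ λ′ x → isLocalMax λ′ x ≡
  (profileℕ (rows λ′) (predℤ x) ℕ.<ᵇ profileℕ (rows λ′) x) ∧ (profileℕ (rows λ′) (sucℤ x) ℕ.<ᵇ profileℕ (rows λ′) x)
isLocalMax≡ λ′ x =
  trans (isYes≗does _) (profile-at-neighbours (λ a b c → does ((b ℤ.<? a) ×-dec (c ℤ.<? a))) λ′ x)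

Δ²-profileℕ : ∀ xs x → Δ² (ℕtoℚ ∘ profileℕ xs) x
  ≡ Δ² (ℕtoℚ ∘ ℤ.∣_∣) x ℚ.+ (Δ² (ℕtoℚ ∘ boxesWithContent xs) x ℚ.+ Δ² (ℕtoℚ ∘ boxesWithContent xs) x)
Δ²-profileℕ xs x =
  trans (Δ²-cong ℕtoℚ-profileℕ x) (trans (Δ²-+ (ℕtoℚ ∘ ℤ.∣_∣) (λ y → c y ℚ.+ c y) x) (cong (Δ² (ℕtoℚ ∘ ℤ.∣_∣) x ℚ.+_) (Δ²-+ c c x)))
  where
  c : ℤ → ℚ
  c = ℕtoℚ ∘ boxesWithContent xs
  ℕtoℚ-profileℕ : ∀ y → ℕtoℚ (profileℕ xs y) ≡ ℕtoℚ ℤ.∣ y ∣ ℚ.+ (c y ℚ.+ c y)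
  ℕtoℚ-profileℕ y = trans (ℕtoℚ-+ ℤ.∣ y ∣ (2 ℕ.* n)) (cong (ℕtoℚ ℤ.∣ y ∣ ℚ.+_)
    (trans (ℕtoℚ-+ n (n ℕ.+ 0)) (cong (λ m → c y ℚ.+ ℕtoℚ m) (ℕ.+-identityʳ n))))
    where
    n : ℕ
    n = boxesWithContent xs y

ℕtoℚ-Δ²-zero : ∀ a b c → a ℕ.+ b ≡ c ℕ.+ c → ℕtoℚ a ℚ.+ ℕtoℚ b ℚ.- (ℕtoℚ c ℚ.+ ℕtoℚ c) ≡ 0ℚ
ℕtoℚ-Δ²-zero a b c a+b≡c+c =
  trans (cong (ℚ._- (ℕtoℚ c ℚ.+ ℕtoℚ c)) (trans (sym (ℕtoℚ-+ a b)) (trans (cong ℕtoℚ a+b≡c+c) (ℕtoℚ-+ c c))))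
        (ℚ.+-inverseʳ (ℕtoℚ c ℚ.+ ℕtoℚ c))

-- |x| is affine away from 0, and x ^ (k + 1) vanishes at 0.
Δ²-abs·pow : ∀ k x → Δ² (ℕtoℚ ∘ ℤ.∣_∣) x ℚ.* ℤtoℚ x ^ℚ suc k ≡ 0ℚ
Δ²-abs·pow k (+ zero) =
  trans (cong (Δ² (ℕtoℚ ∘ ℤ.∣_∣) (+ 0) ℚ.*_) (ℚ.*-zeroˡ (ℤtoℚ (+ 0) ^ℚ k))) (ℚ.*-zeroʳ (Δ² (ℕtoℚ ∘ ℤ.∣_∣) (+ 0)))
Δ²-abs·pow k (+ suc n) =
  trans (cong (ℚ._* ℤtoℚ (+ suc n) ^ℚ suc k) (ℕtoℚ-Δ²-zero n (suc (suc n)) (suc n) (ℕ.+-suc n (suc n))))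
        (ℚ.*-zeroˡ (ℤtoℚ (+ suc n) ^ℚ suc k))
Δ²-abs·pow k -[1+ zero ] = ℚ.*-zeroˡ (ℤtoℚ -[1+ 0 ] ^ℚ suc k)
Δ²-abs·pow k -[1+ suc m ] =
  trans (cong (ℚ._* ℤtoℚ -[1+ suc m ] ^ℚ suc k)
              (ℕtoℚ-Δ²-zero (suc (suc (suc m))) (suc m) (suc (suc m)) (cong (suc ∘ suc) (sym (ℕ.+-suc m (suc m))))))
        (ℚ.*-zeroˡ (ℤtoℚ -[1+ suc m ] ^ℚ suc k))

extremumTerm : YoungDiagram → ℕ → ℤ → ℚ
extremumTerm λ′ k x =
  (if isLocalMin λ′ x then ℤtoℚ x ^ℚ k else 0ℚ) ℚ.- (if isLocalMax λ′ x then ℤtoℚ x ^ℚ k else 0ℚ)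

extremumTerm≡Δ² : ∀ λ′ k x →
  extremumTerm λ′ (suc k) x ≡ Δ² (ℕtoℚ ∘ boxesWithContent (rows λ′)) x ℚ.* ℤtoℚ x ^ℚ suc k
extremumTerm≡Δ² λ′ k x = begin
  extremumTerm λ′ (suc k) x
    ≡⟨ cong₂ (λ m M → (if m then X else 0ℚ) ℚ.- (if M then X else 0ℚ)) (isLocalMin≡ λ′ x) (isLocalMax≡ λ′ x) ⟩
  (if (P x ℕ.<ᵇ P (predℤ x)) ∧ (P x ℕ.<ᵇ P (sucℤ x)) then X else 0ℚ)
    ℚ.- (if (P (predℤ x) ℕ.<ᵇ P x) ∧ (P (sucℤ x) ℕ.<ᵇ P x) then X else 0ℚ)
    ≡⟨ extremum-indicator X left right ⟩
  ½ ℚ.* Δ² (ℕtoℚ ∘ P) x ℚ.* X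
    ≡⟨ cong (λ d → ½ ℚ.* d ℚ.* X) (Δ²-profileℕ (rows λ′) x) ⟩
  ½ ℚ.* (Δ² (ℕtoℚ ∘ ℤ.∣_∣) x ℚ.+ (Δ² c x ℚ.+ Δ² c x)) ℚ.* X
    ≡⟨ solve 3 (λ a d X → con ½ :* (a :+ (d :+ d)) :* X := con ½ :* (a :* X) :+ d :* X) refl
             (Δ² (ℕtoℚ ∘ ℤ.∣_∣) x) (Δ² c x) X ⟩
  ½ ℚ.* (Δ² (ℕtoℚ ∘ ℤ.∣_∣) x ℚ.* X) ℚ.+ Δ² c x ℚ.* X
    ≡⟨ cong (λ z → ½ ℚ.* z ℚ.+ Δ² c x ℚ.* X) (Δ²-abs·pow k x) ⟩
  ½ ℚ.* 0ℚ ℚ.+ Δ² c x ℚ.* X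
    ≡⟨ ℚ.+-identityˡ (Δ² c x ℚ.* X) ⟩
  Δ² c x ℚ.* X ∎
  where
  open ≡-Reasoning
  X : ℚ
  X = ℤtoℚ x ^ℚ suc k
  P : ℤ → ℕ
  P = profileℕ (rows λ′)
  c : ℤ → ℚ
  c = ℕtoℚ ∘ boxesWithContent (rows λ′)
  left : Adjacent (P (predℤ x)) (P x)
  left = subst (Adjacent (P (predℤ x)) ∘ P) (sucℤ-predℤ x) (profileℕ-adjacent (nonincr λ′) (positive λ′) (predℤ x))
  right : Adjacent (P (sucℤ x)) (P x)
  right = Sum.swap (profileℕ-adjacent (nonincr λ′) (positive λ′) x)

𝟙[_≡_] : ℤ → ℤ → ℚ
𝟙[ x ≡ y ] = if does (x ℤ.≟ y) then 1ℚ else 0ℚ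

𝟙-cong : ∀ {a b c d} → (a ≡ b → c ≡ d) → (c ≡ d → a ≡ b) → 𝟙[ a ≡ b ] ≡ 𝟙[ c ≡ d ]
𝟙-cong {a} {b} {c} {d} to from with a ℤ.≟ b | c ℤ.≟ d
... | yes _   | yes _   = refl
... | no _    | no _    = refl
... | yes a≡b | no c≢d  = contradiction (to a≡b) c≢d
... | no a≢b  | yes c≡d = contradiction (from c≡d) a≢b

𝟙-≡ : ∀ {a b} → a ≡ b → 𝟙[ a ≡ b ] ≡ 1ℚ
𝟙-≡ {a} {b} a≡b with a ℤ.≟ b
... | yes _   = refl
... | no a≢b  = contradiction a≡b a≢b

𝟙-≢ : ∀ {a b} → a ≢ b → 𝟙[ a ≡ b ] ≡ 0ℚ
𝟙-≢ {a} {b} a≢b with a ℤ.≟ b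
... | yes a≡b = contradiction a≡b a≢b
... | no _    = refl

𝟙-+-transpose : ∀ y t s → 𝟙[ y ℤ.+ t ≡ s ] ≡ 𝟙[ y ≡ s ℤ.- t ]
𝟙-+-transpose y t s =
  𝟙-cong (λ e → trans (sym (x+t-t≡x y t)) (cong (ℤ._- t) e)) (λ e → trans (cong (ℤ._+ t) e) (x-t+t≡x s t))

𝟙-predℤ : ∀ y c → 𝟙[ predℤ y ≡ c ] ≡ 𝟙[ y ≡ sucℤ c ]
𝟙-predℤ y c = 𝟙-cong (λ e → trans (sym (sucℤ-predℤ y)) (cong sucℤ e)) (λ e → trans (cong predℤ e) (predℤ-sucℤ c))

𝟙-sucℤ : ∀ y c → 𝟙[ sucℤ y ≡ c ] ≡ 𝟙[ y ≡ predℤ c ]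
𝟙-sucℤ y c = 𝟙-cong (λ e → trans (sym (predℤ-sucℤ y)) (cong predℤ e)) (λ e → trans (cong sucℤ e) (sucℤ-predℤ c))

inRow≡∑𝟙 : ∀ a y → ℕtoℚ (inRow a y) ≡ ∑[ s < a ] 𝟙[ y ≡ + s ]
inRow≡∑𝟙 zero    (+ n)     = refl
inRow≡∑𝟙 zero    -[1+ n ]  = refl
inRow≡∑𝟙 (suc a) (+ zero)  = sym (trans (cong (1ℚ ℚ.+_) (∑-zero a (λ _ _ → refl))) (ℚ.+-identityʳ 1ℚ))
inRow≡∑𝟙 (suc a) (+ suc n) = trans (inRow≡∑𝟙 a (+ n)) (sym (ℚ.+-identityˡ _))
inRow≡∑𝟙 (suc a) -[1+ m ]  = sym (∑-zero (suc a) (λ _ _ → refl))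

rowTerm : (ℤ → ℚ) → ℕ × ℕ → ℚ
rowTerm h (i , a) = ∇ h (sucℤ (+ a ℤ.- + i)) ℚ.- ∇ h (sucℤ (+ 0 ℤ.- + i))

-- The window [−(l + 1), λ₁ + 1] of the definition of p̃ is indexed by point n, n < N.
module SummationByParts (l λ₁ : ℕ) (h : ℤ → ℚ) where

  N : ℕ
  N = l ℕ.+ λ₁ ℕ.+ 3

  L : ℕ
  L = l ℕ.+ 1

  point : ℕ → ℤ
  point n = + n ℤ.- + L

  pairing : (ℤ → ℚ) → ℚ
  pairing φ = ∑[ n < N ] (Δ² φ (point n) ℚ.* h (point n))

  pairing-cong : ∀ {φ ψ : ℤ → ℚ} → (∀ y → φ y ≡ ψ y) → pairing φ ≡ pairing ψ
  pairing-cong φ≡ψ = ∑-cong N (λ n _ → cong (ℚ._* h (point n)) (Δ²-cong φ≡ψ (point n)))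

  pairing-+ : ∀ (φ ψ : ℤ → ℚ) → pairing (λ y → φ y ℚ.+ ψ y) ≡ pairing φ ℚ.+ pairing ψ
  pairing-+ φ ψ =
    trans (∑-cong N (λ n _ → trans (cong (ℚ._* h (point n)) (Δ²-+ φ ψ (point n)))
                                   (ℚ.*-distribʳ-+ (h (point n)) (Δ² φ (point n)) (Δ² ψ (point n)))))
          (∑-distrib-+ N (λ n → Δ² φ (point n) ℚ.* h (point n)) (λ n → Δ² ψ (point n) ℚ.* h (point n)))

  pairing-zero : pairing (λ _ → 0ℚ) ≡ 0ℚ
  pairing-zero = ∑-zero N (λ n _ → ℚ.*-zeroˡ (h (point n)))

  pairing-∑ : ∀ a (F : ℕ → ℤ → ℚ) → pairing (λ y → ∑[ s < a ] F s y) ≡ ∑[ s < a ] pairing (F s)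
  pairing-∑ zero    F = pairing-zero
  pairing-∑ (suc a) F =
    trans (pairing-+ (F 0) (λ y → ∑[ s < a ] F (suc s) y)) (cong (pairing (F 0) ℚ.+_) (pairing-∑ a (F ∘ suc)))

  InWindow : ℤ → Set
  InWindow x = ∃ λ m → m < N × point m ≡ x

  point-injective : ∀ {m n} → point m ≡ point n → m ≡ n
  point-injective {m} {n} eq =
    ℤ.+-injective (trans (sym (x-t+t≡x (+ m) (+ L))) (trans (cong (ℤ._+ + L) eq) (x-t+t≡x (+ n) (+ L))))

  ∑-𝟙-point : ∀ {x} → InWindow x → ∑[ n < N ] (𝟙[ point n ≡ x ] ℚ.* h (point n)) ≡ h x
  ∑-𝟙-point {x} (m , m<N , point-m≡x) =
    trans (∑-single (λ n → 𝟙[ point n ≡ x ] ℚ.* h (point n)) m<N vanishes)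
          (trans (cong₂ ℚ._*_ (𝟙-≡ point-m≡x) (cong h point-m≡x)) (ℚ.*-identityˡ (h x)))
    where
    vanishes : ∀ n → n ≢ m → 𝟙[ point n ≡ x ] ℚ.* h (point n) ≡ 0ℚ
    vanishes n n≢m =
      trans (cong (ℚ._* h (point n)) (𝟙-≢ (λ e → n≢m (point-injective (trans e (sym point-m≡x))))))
            (ℚ.*-zeroˡ (h (point n)))

  -- Δ² is self-adjoint: pairing a point mass with h gives Δ² h.
  pairing-𝟙 : ∀ {c} → InWindow (predℤ c) → InWindow c → InWindow (sucℤ c) →
              pairing (λ y → 𝟙[ y ≡ c ]) ≡ Δ² h c
  pairing-𝟙 {c} in-pred in-c in-suc = begin
    pairing (λ y → 𝟙[ y ≡ c ])
      ≡⟨ ∑-cong N (λ n _ → pointwise (point n)) ⟩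
    ∑[ n < N ] (δ (predℤ c) n ℚ.+ δ (sucℤ c) n ℚ.- (δ c n ℚ.+ δ c n))
      ≡⟨ ∑-distrib-- N (λ n → δ (predℤ c) n ℚ.+ δ (sucℤ c) n) (λ n → δ c n ℚ.+ δ c n) ⟩
    ∑[ n < N ] (δ (predℤ c) n ℚ.+ δ (sucℤ c) n) ℚ.- ∑[ n < N ] (δ c n ℚ.+ δ c n)
      ≡⟨ cong₂ ℚ._-_ (∑-distrib-+ N (δ (predℤ c)) (δ (sucℤ c))) (∑-distrib-+ N (δ c) (δ c)) ⟩
    ∑< N (δ (predℤ c)) ℚ.+ ∑< N (δ (sucℤ c)) ℚ.- (∑< N (δ c) ℚ.+ ∑< N (δ c))
      ≡⟨ cong₂ ℚ._-_ (cong₂ ℚ._+_ (∑-𝟙-point in-pred) (∑-𝟙-point in-suc))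
                     (cong₂ ℚ._+_ (∑-𝟙-point in-c) (∑-𝟙-point in-c)) ⟩
    Δ² h c ∎
    where
    open ≡-Reasoning
    δ : ℤ → ℕ → ℚ
    δ x n = 𝟙[ point n ≡ x ] ℚ.* h (point n)
    pointwise : ∀ y → Δ² (λ z → 𝟙[ z ≡ c ]) y ℚ.* h y
      ≡ 𝟙[ y ≡ predℤ c ] ℚ.* h y ℚ.+ 𝟙[ y ≡ sucℤ c ] ℚ.* h y ℚ.- (𝟙[ y ≡ c ] ℚ.* h y ℚ.+ 𝟙[ y ≡ c ] ℚ.* h y)
    pointwise y rewrite 𝟙-predℤ y c | 𝟙-sucℤ y c =
      solve 4 (λ a b e H → (a :+ b :- (e :+ e)) :* H := b :* H :+ a :* H :- (e :* H :+ e :* H)) refl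
        𝟙[ y ≡ sucℤ c ] 𝟙[ y ≡ predℤ c ] 𝟙[ y ≡ c ] (h y)

  λ₁+L<N : λ₁ ℕ.+ L < N
  λ₁+L<N = ℕ.≤-trans (ℕ.n≤1+n _) (ℕ.≤-reflexive (ℕ-Ring.solve 2
    (λ l λ₁ → ℕ-Ring.con 2 ℕ-Ring.:+ (λ₁ ℕ-Ring.:+ (l ℕ-Ring.:+ ℕ-Ring.con 1))
              ℕ-Ring.:= l ℕ-Ring.:+ λ₁ ℕ-Ring.:+ ℕ-Ring.con 3) refl l λ₁))

  inWindow : ∀ {s t} → t ≤ L → s ≤ λ₁ → InWindow (+ s ℤ.- + t)
  inWindow {s} {t} t≤L s≤λ₁ = s ℕ.+ (L ∸ t) , ℕ.≤-<-trans (ℕ.+-mono-≤ s≤λ₁ (ℕ.m∸n≤m L t)) λ₁+L<N , at-point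
    where
    at-point : point (s ℕ.+ (L ∸ t)) ≡ + s ℤ.- + t
    at-point = trans (cong (λ u → + s ℤ.+ u ℤ.- + L) (sym (+m-+n≡+[m∸n] t≤L)))
      (ℤ-Ring.solve 3 (λ s t L → s ℤ-Ring.:+ (L ℤ-Ring.:- t) ℤ-Ring.:- L ℤ-Ring.:= s ℤ-Ring.:- t) refl (+ s) (+ t) (+ L))

  pairing-row : ∀ {t a} → t < l → a ≤ λ₁ →
    pairing (λ y → ℕtoℚ (inRow a (y ℤ.+ + t))) ≡ ∇ h (+ a ℤ.- + t) ℚ.- ∇ h (+ 0 ℤ.- + t)
  pairing-row {t} {a} t<l a≤λ₁ = begin
    pairing (λ y → ℕtoℚ (inRow a (y ℤ.+ + t)))
      ≡⟨ pairing-cong (λ y → trans (inRow≡∑𝟙 a (y ℤ.+ + t)) (∑-cong a (λ s _ → 𝟙-+-transpose y (+ t) (+ s)))) ⟩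
    pairing (λ y → ∑[ s < a ] 𝟙[ y ≡ + s ℤ.- + t ])
      ≡⟨ pairing-∑ a (λ s y → 𝟙[ y ≡ + s ℤ.- + t ]) ⟩
    ∑[ s < a ] pairing (λ y → 𝟙[ y ≡ + s ℤ.- + t ])
      ≡⟨ ∑-cong a pairing-box ⟩
    ∑[ s < a ] (∇ h (+ suc s ℤ.- + t) ℚ.- ∇ h (+ s ℤ.- + t))
      ≡⟨ ∑-telescope a (λ s → ∇ h (+ s ℤ.- + t)) ⟩
    ∇ h (+ a ℤ.- + t) ℚ.- ∇ h (+ 0 ℤ.- + t) ∎
    where
    open ≡-Reasoning
    1+t≤L : suc t ≤ L
    1+t≤L = ℕ.≤-trans t<l (ℕ.m≤m+n l 1)
    pairing-box : ∀ s → s < a → pairing (λ y → 𝟙[ y ≡ + s ℤ.- + t ]) ≡ ∇ h (+ suc s ℤ.- + t) ℚ.- ∇ h (+ s ℤ.- + t)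
    pairing-box s s<a = begin
      pairing (λ y → 𝟙[ y ≡ + s ℤ.- + t ])
        ≡⟨ pairing-𝟙 in-pred in-c in-suc ⟩
      Δ² h (+ s ℤ.- + t)
        ≡⟨ Δ²≡∇-∇ h (+ s ℤ.- + t) ⟩
      ∇ h (sucℤ (+ s ℤ.- + t)) ℚ.- ∇ h (+ s ℤ.- + t)
        ≡⟨ cong (λ u → ∇ h u ℚ.- ∇ h (+ s ℤ.- + t)) (sucℤ[m-n]≡1+m-n s t) ⟩
      ∇ h (+ suc s ℤ.- + t) ℚ.- ∇ h (+ s ℤ.- + t) ∎
      where
      s≤λ₁ : s ≤ λ₁
      s≤λ₁ = ℕ.≤-trans (ℕ.<⇒≤ s<a) a≤λ₁
      in-pred : InWindow (predℤ (+ s ℤ.- + t))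
      in-pred = subst InWindow (sym (predℤ[m-n]≡m-[1+n] s t)) (inWindow 1+t≤L s≤λ₁)
      in-c : InWindow (+ s ℤ.- + t)
      in-c = inWindow (ℕ.<⇒≤ 1+t≤L) s≤λ₁
      in-suc : InWindow (sucℤ (+ s ℤ.- + t))
      in-suc = subst InWindow (sym (sucℤ[m-n]≡1+m-n s t)) (inWindow (ℕ.<⇒≤ 1+t≤L) (ℕ.≤-trans s<a a≤λ₁))

  pairing-rows : ∀ xs t → All (_≤ λ₁) xs → t ℕ.+ length xs ≤ l →
    pairing (λ y → ℕtoℚ (boxesWithContent xs (y ℤ.+ + t))) ≡ sumℚ (map (rowTerm h) (indexFrom (suc t) xs))
  pairing-rows []       t _              _        = pairing-zero
  pairing-rows (a ∷ as) t (a≤λ₁ ∷ as≤λ₁) t+len≤l = begin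
    pairing (λ y → ℕtoℚ (boxesWithContent (a ∷ as) (y ℤ.+ + t)))
      ≡⟨ pairing-cong split ⟩
    pairing (λ y → ℕtoℚ (inRow a (y ℤ.+ + t)) ℚ.+ ℕtoℚ (boxesWithContent as (y ℤ.+ + suc t)))
      ≡⟨ pairing-+ (λ y → ℕtoℚ (inRow a (y ℤ.+ + t))) (λ y → ℕtoℚ (boxesWithContent as (y ℤ.+ + suc t))) ⟩
    pairing (λ y → ℕtoℚ (inRow a (y ℤ.+ + t))) ℚ.+ pairing (λ y → ℕtoℚ (boxesWithContent as (y ℤ.+ + suc t)))
      ≡⟨ cong₂ ℚ._+_ (trans (pairing-row t<l a≤λ₁) first-row) (pairing-rows as (suc t) as≤λ₁ rest≤l) ⟩
    rowTerm h (suc t , a) ℚ.+ sumℚ (map (rowTerm h) (indexFrom (suc (suc t)) as)) ∎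
    where
    open ≡-Reasoning
    rest≤l : suc t ℕ.+ length as ≤ l
    rest≤l = subst (_≤ l) (ℕ.+-suc t (length as)) t+len≤l
    t<l : t < l
    t<l = ℕ.m+n≤o⇒m≤o (suc t) rest≤l
    split : ∀ y → ℕtoℚ (boxesWithContent (a ∷ as) (y ℤ.+ + t))
                ≡ ℕtoℚ (inRow a (y ℤ.+ + t)) ℚ.+ ℕtoℚ (boxesWithContent as (y ℤ.+ + suc t))
    split y = trans (ℕtoℚ-+ (inRow a (y ℤ.+ + t)) _)
                    (cong (λ z → ℕtoℚ (inRow a (y ℤ.+ + t)) ℚ.+ ℕtoℚ (boxesWithContent as z)) (sucℤ-+ʳ y (+ t)))
    first-row : ∇ h (+ a ℤ.- + t) ℚ.- ∇ h (+ 0 ℤ.- + t) ≡ rowTerm h (suc t , a)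
    first-row = sym (cong₂ (λ u v → ∇ h u ℚ.- ∇ h v) (sucℤ[m-[1+n]]≡m-n a t) (sucℤ[m-[1+n]]≡m-n 0 t))

rows-≤-head : ∀ {xs} → Linked _≥_ xs → All (_≤ fromMaybe 0 (head xs)) xs
rows-≤-head {[]}     _      = []
rows-≤-head {a ∷ as} sorted = ℕ.≤-refl ∷ tail-≤-head sorted

p̃≡∑rowTerm : ∀ k λ′ → p̃ (suc k) λ′ ≡ sumℚ (map (rowTerm (λ x → ℤtoℚ x ^ℚ suc k)) (indexedRows λ′))
p̃≡∑rowTerm k λ′ = begin
  p̃ (suc k) λ′
    ≡⟨ cong sumℚ (List.map-∘ (upTo N)) ⟨
  sumℚ (map (extremumTerm λ′ (suc k) ∘ point) (upTo N))
    ≡⟨ sumℚ-map-upTo (extremumTerm λ′ (suc k) ∘ point) N ⟩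
  ∑[ n < N ] extremumTerm λ′ (suc k) (point n)
    ≡⟨ ∑-cong N (λ n _ → extremumTerm≡Δ² λ′ k (point n)) ⟩
  pairing (ℕtoℚ ∘ boxesWithContent (rows λ′))
    ≡⟨ pairing-cong (λ y → cong (ℕtoℚ ∘ boxesWithContent (rows λ′)) (ℤ.+-identityʳ y)) ⟨
  pairing (λ y → ℕtoℚ (boxesWithContent (rows λ′) (y ℤ.+ + 0)))
    ≡⟨ pairing-rows (rows λ′) 0 (rows-≤-head (nonincr λ′)) ℕ.≤-refl ⟩
  sumℚ (map (rowTerm (λ x → ℤtoℚ x ^ℚ suc k)) (indexFrom 1 (rows λ′)))
    ≡⟨ cong (sumℚ ∘ map (rowTerm (λ x → ℤtoℚ x ^ℚ suc k))) (indexedRows≡indexFrom λ′) ⟨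
  sumℚ (map (rowTerm (λ x → ℤtoℚ x ^ℚ suc k)) (indexedRows λ′)) ∎
  where
  open ≡-Reasoning
  open SummationByParts (length (rows λ′)) (fromMaybe 0 (head (rows λ′))) (λ x → ℤtoℚ x ^ℚ suc k)

oddRowTerm : ℕ → ℕ × ℕ → ℚ
oddRowTerm k (i , a) = oddPart k (ℕtoℚ a ℚ.- ℕtoℚ i ℚ.+ ½) ℚ.- oddPart k (ℚ.- ℕtoℚ i ℚ.+ ½)

ℤtoℚ-[m-n] : ∀ m n → ℤtoℚ (+ m ℤ.- + n) ≡ ℕtoℚ m ℚ.- ℕtoℚ n
ℤtoℚ-[m-n] m n = trans (ℤtoℚ-+ (+ m) (ℤ.- + n)) (cong (ℕtoℚ m ℚ.+_) (ℤtoℚ-neg (+ n)))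

rowTerm-pow : ∀ k r → rowTerm (λ x → ℤtoℚ x ^ℚ k) r ≡ oddRowTerm k r
rowTerm-pow k (i , a) = cong₂ ℚ._-_
  (trans (∇-pow k (+ a ℤ.- + i)) (cong (λ w → oddPart k (w ℚ.+ ½)) (ℤtoℚ-[m-n] a i)))
  (trans (∇-pow k (+ 0 ℤ.- + i)) (cong (λ w → oddPart k (w ℚ.+ ½)) (trans (ℤtoℚ-[m-n] 0 i) (ℚ.+-identityˡ (ℚ.- ℕtoℚ i)))))

rhs≡∑oddRowTerm : ∀ k λ′ → rhs k λ′ ≡ sumℚ (map (oddRowTerm k) (indexedRows λ′))
rhs≡∑oddRowTerm k λ′ = begin
  rhs k λ′
    ≡⟨ sumℚ-map-upTo (λ j → oddCoefficient k j ℚ.* p (oddDegree k j) λ′) (oddTerms k) ⟩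
  ∑[ j < oddTerms k ] (oddCoefficient k j ℚ.* sumℚ (map (rowPower (oddDegree k j)) rs))
    ≡⟨ ∑-cong (oddTerms k) (λ j _ → *-distribˡ-sumℚ (oddCoefficient k j) (rowPower (oddDegree k j)) rs) ⟩
  ∑[ j < oddTerms k ] sumℚ (map (λ r → oddCoefficient k j ℚ.* rowPower (oddDegree k j) r) rs)
    ≡⟨ ∑-sumℚ-comm (oddTerms k) (λ j r → oddCoefficient k j ℚ.* rowPower (oddDegree k j) r) rs ⟩
  sumℚ (map (λ r → ∑[ j < oddTerms k ] (oddCoefficient k j ℚ.* rowPower (oddDegree k j) r)) rs)
    ≡⟨ cong sumℚ (List.map-cong odd-expansion rs) ⟩
  sumℚ (map (oddRowTerm k) rs) ∎
  where
  open ≡-Reasoning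
  rs : List (ℕ × ℕ)
  rs = indexedRows λ′
  rowPower : ℕ → ℕ × ℕ → ℚ
  rowPower m (i , a) = (ℕtoℚ a ℚ.- ℕtoℚ i ℚ.+ ½) ^ℚ m ℚ.- (ℚ.- ℕtoℚ i ℚ.+ ½) ^ℚ m
  odd-expansion : ∀ r → ∑[ j < oddTerms k ] (oddCoefficient k j ℚ.* rowPower (oddDegree k j) r) ≡ oddRowTerm k r
  odd-expansion (i , a) = trans
    (∑-cong (oddTerms k) (λ j _ → solve 3 (λ c x y → c :* (x :- y) := c :* x :- c :* y) refl
                                          (oddCoefficient k j) (u ^ℚ oddDegree k j) (v ^ℚ oddDegree k j)))
    (∑-distrib-- (oddTerms k) (λ j → oddCoefficient k j ℚ.* u ^ℚ oddDegree k j)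
                              (λ j → oddCoefficient k j ℚ.* v ^ℚ oddDegree k j))
    where
    u v : ℚ
    u = ℕtoℚ a ℚ.- ℕtoℚ i ℚ.+ ½
    v = ℚ.- ℕtoℚ i ℚ.+ ½

proposition2p7 : (k : ℕ) → 2 ≤ k → (λ′ : YoungDiagram) → p̃ k λ′ ≡ rhs k λ′
proposition2p7 (suc k) _ λ′ = begin
  p̃ (suc k) λ′                                                    ≡⟨ p̃≡∑rowTerm k λ′ ⟩
  sumℚ (map (rowTerm (λ x → ℤtoℚ x ^ℚ suc k)) (indexedRows λ′))  ≡⟨ cong sumℚ (List.map-cong (rowTerm-pow (suc k)) (indexedRows λ′)) ⟩
  sumℚ (map (oddRowTerm (suc k)) (indexedRows λ′))                ≡⟨ rhs≡∑oddRowTerm (suc k) λ′ ⟨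
  rhs (suc k) λ′                                                   ∎
  where open ≡-Reasoning
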